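{- Suppose that $g(K_a,K_b)<(a-1)(b-1)$ for some positive integers $a,b$. Then there is a constant $\beta<1$ such that $g(n)\le \beta n^2$ for all $n$.
   Context: A complete bipartite subgraph of a graph $G$ is given by two nonempty disjoint vertex sets $X,Y$ of $G$ such that every pair $xy$ with $x\in X,y\in Y$ is an edge of $G$; its edge set is all such pairs. For graphs $G,H$, a block is a set of the form $E(B_1)\times E(B_2)$ where $B_1$ is a complete bipartite subgraph of $G$ and $B_2$ a complete bipartite subgraph of $H$. $g(G,H)$ is the minimum number of blocks needed to partition $E(G)\times E(H)$, and $g(n)=g(K_n,K_n)$, where $K_n$ is the complete graph on $n$ vertices. -}

module Defs where

open import Data.Nat using (ℕ; _≤_)
open import Data.Fin using (Fin) renaming (_<_ to _<ᶠ_)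
open import Data.Fin.Subset using (Subset; _∈_; _∉_; Nonempty)
open import Data.Vec using (Vec; lookup)
open import Data.Product using (Σ; _×_; _,_; ∃)
open import Data.Sum using (_⊎_)
open import Relation.Binary.PropositionalEquality using (_≡_)

-- An edge of the complete graph K_n on vertex set Fin n:
-- the unordered pair {u, v} is represented by the ordered pair (u , v) with u < v.
Edge : ℕ → Set
Edge n = Σ (Fin n × Fin n) λ { (u , v) → u <ᶠ v }

-- A complete bipartite subgraph of K_n: two nonempty disjoint vertex sets X, Y.
-- (In K_n every pair xy with x ∈ X, y ∈ Y, X ∩ Y = ∅, is an edge.)
record Biclique (n : ℕ) : Set where
  field
    X Y       : Subset n
    X-nonempty : Nonempty X
    Y-nonempty : Nonempty Y
    disjoint  : ∀ i → i ∈ X → i ∉ Y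

_∈E_ : ∀ {n} → Edge n → Biclique n → Set
((u , v) , _) ∈E B = (u ∈ X × v ∈ Y) ⊎ (u ∈ Y × v ∈ X)
  where open Biclique B

Block : ℕ → ℕ → Set
Block a b = Biclique a × Biclique b

_∈Block_ : ∀ {a b} → Edge a × Edge b → Block a b → Set
(e , f) ∈Block (B₁ , B₂) = (e ∈E B₁) × (f ∈E B₂)

IsPartition : ∀ {a b k} → Vec (Block a b) k → Set
IsPartition {a} {b} {k} bs =
  ∀ (e : Edge a) (f : Edge b) →
    ∃ λ (i : Fin k) → ((e , f) ∈Block lookup bs i)
      × (∀ (j : Fin k) → (e , f) ∈Block lookup bs j → j ≡ i)

HasPartition : ℕ → ℕ → ℕ → Set
HasPartition a b k = ∃ λ (bs : Vec (Block a b) k) → IsPartition bs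

IsG : ℕ → ℕ → ℕ → Set
IsG a b k = HasPartition a b k × (∀ k' → HasPartition a b k' → k ≤ k')

module Submission where

-- Proposition 2: if g(K_a, K_b) < (a − 1)(b − 1), then g(n) ≤ β n² for all n
-- with β = Z / (Z + 1) < 1, where Z = (ab)⁴.
--
-- Products of stars always partition E(K_n) × E(K_m) into (n − 1)(m − 1)
-- blocks; a partition with d fewer blocks is a "saving" of d.  Bicliques are
-- Boolean predicates on an arbitrary vertex type and a partition of
-- E(G) × E(H) is a family of blocks covering G ⊗ H exactly once, counted with
-- multiplicities in ℕ, so that unions, products and relabellings of families
-- become identities between finite sums.  The development:
--   1. stars decompose K_n, and savings are monotone in the number of
--      vertices (cover the edges of a new vertex by star × stars);
--   2. blow-up: K_{at} is K_a with every vertex replaced by a copy of K_t,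
--      so savings δ for K_a × K_b and d for K_t × K_s combine into a saving
--      δ + abd for K_{at} × K_{bs};
--   3. the partitions of Defs are exactly the coverings of K ⊗ K, so the
--      hypothesis is a saving δ ≥ 1 and g(n) bounds the size of coverings;
--   4. iterating the blow-up gives savings of order n²/(ab)² at the powers
--      of N = ab, monotonicity fills the gaps, and m(Z + 1) ≤ Z n² follows.

open import Defs
open import Data.Nat using (ℕ; _*_; _∸_; _<_; _≤_; _≥_)
open import Data.Product using (Σ; _×_; ∃)
open import Data.Nat using (zero; suc; _+_; pred; _^_; z≤n; s≤s; _≤?_)
open import Data.Nat.Properties
open import Data.Nat.Tactic.RingSolver using (solve-∀)
open import Algebra.Properties.Semiring.Sum +-*-semiring
  using (sum; sum-syntax; sum-cong-≗; sum-replicate-zero; *-distribˡ-sum; *-distribʳ-sum)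
open import Data.Bool using (Bool; true; false; _∧_; _∨_; not; if_then_else_)
open import Data.Bool.Properties using (∧-zeroʳ; ∧-comm; ∨-comm; ∨-zeroʳ)
open import Data.Fin using (Fin; zero; suc; remQuot; combine)
import Data.Fin.Properties as Finₚ
open import Data.Maybe using (Maybe; just; nothing)
open import Data.Vec using (Vec; []; _∷_; _++_; map; concat; tabulate; lookup)
open import Data.Vec.Properties using (lookup∘tabulate; lookup-map; []=⇒lookup; lookup⇒[]=)
open import Data.Fin.Subset using (Subset; _∈_)
open import Relation.Binary.Definitions using (tri<; tri≈; tri>)
open import Data.Product using (_,_; proj₁; proj₂; swap; uncurry)
open import Data.Sum using (_⊎_; inj₁; inj₂) renaming (map to ⊎-map)
open import Function using (_∘_; id; _⇔_; mk⇔; Equivalence)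
open Equivalence using (to; from)
open import Relation.Nullary using (yes; no; contradiction)
open import Relation.Binary.Definitions using (DecidableEquality)
open import Relation.Binary.PropositionalEquality

private
  variable
    A V V′ W W′ : Set
    k l n : ℕ

ind : Bool → ℕ
ind true  = 1
ind false = 0

ind≤1 : ∀ b → ind b ≤ 1
ind≤1 true  = ≤-refl
ind≤1 false = z≤n

crosses : Bool → Bool → Bool → Bool → Bool
crosses xu yv yu xv = (xu ∧ yv) ∨ (yu ∧ xv)

crosses≡1⇔ : ∀ xu yv yu xv → ind (crosses xu yv yu xv) ≡ 1
  ⇔ ((xu ≡ true × yv ≡ true) ⊎ (yu ≡ true × xv ≡ true))
crosses≡1⇔ xu yv yu xv = mk⇔ (forward xu yv yu xv) (backward xu yv yu xv)
  where
    forward : ∀ xu yv yu xv → ind (crosses xu yv yu xv) ≡ 1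
      → (xu ≡ true × yv ≡ true) ⊎ (yu ≡ true × xv ≡ true)
    forward true  true  _     _     _ = inj₁ (refl , refl)
    forward true  false true  true  _ = inj₂ (refl , refl)
    forward false _     true  true  _ = inj₂ (refl , refl)
    forward true  false true  false ()
    forward true  false false _     ()
    forward false _     true  false ()
    forward false _     false _     ()
    backward : ∀ xu yv yu xv → (xu ≡ true × yv ≡ true) ⊎ (yu ≡ true × xv ≡ true)
      → ind (crosses xu yv yu xv) ≡ 1
    backward _  _  _ _ (inj₁ (refl , refl)) = refl
    backward xu yv _ _ (inj₂ (refl , refl)) = cong ind (∨-zeroʳ (xu ∧ yv))

record Bic (V : Set) : Set where
  constructor mkBic
  field
    X Y       : V → Bool
    X-witness : Σ V λ v → X v ≡ true
    Y-witness : Σ V λ v → Y v ≡ true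
    disjoint  : ∀ v → X v ≡ true → Y v ≡ false
open Bic

Graph : Set → Set
Graph V = V → V → ℕ

edges : Bic V → Graph V
edges B u v = ind (crosses (X B u) (Y B v) (Y B u) (X B v))

edges-irreflexive : ∀ (B : Bic V) u → edges B u u ≡ 0
edges-irreflexive B u with X B u in u∈X
... | true  rewrite disjoint B u u∈X = refl
... | false = cong ind (∧-zeroʳ (Y B u))

edges-sym : ∀ (B : Bic V) u v → edges B u v ≡ edges B v u
edges-sym B u v = cong ind (trans (∨-comm (X B u ∧ Y B v) (Y B u ∧ X B v))
  (cong₂ _∨_ (∧-comm (Y B u) (X B v)) (∧-comm (X B u) (Y B v))))

edges≤1 : ∀ (B : Bic V) u v → edges B u v ≤ 1
edges≤1 B u v = ind≤1 (crosses (X B u) (Y B v) (Y B u) (X B v))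

Σᵥ : (A → ℕ) → Vec A k → ℕ
Σᵥ w []       = 0
Σᵥ w (x ∷ xs) = w x + Σᵥ w xs

Σᵥ-cong : ∀ {w w′ : A → ℕ} → (∀ x → w x ≡ w′ x) → (xs : Vec A k) → Σᵥ w xs ≡ Σᵥ w′ xs
Σᵥ-cong eq []       = refl
Σᵥ-cong eq (x ∷ xs) = cong₂ _+_ (eq x) (Σᵥ-cong eq xs)

Σᵥ-++ : ∀ (w : A → ℕ) (xs : Vec A k) (ys : Vec A l) → Σᵥ w (xs ++ ys) ≡ Σᵥ w xs + Σᵥ w ys
Σᵥ-++ w []       ys = refl
Σᵥ-++ w (x ∷ xs) ys = trans (cong (w x +_) (Σᵥ-++ w xs ys)) (sym (+-assoc (w x) _ _))

Σᵥ-map : ∀ (w : A → ℕ) (f : V → A) (xs : Vec V k) → Σᵥ w (map f xs) ≡ Σᵥ (w ∘ f) xs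
Σᵥ-map w f []       = refl
Σᵥ-map w f (x ∷ xs) = cong (w (f x) +_) (Σᵥ-map w f xs)

Σᵥ-concat : ∀ (w : A → ℕ) (xss : Vec (Vec A l) k) → Σᵥ w (concat xss) ≡ Σᵥ (Σᵥ w) xss
Σᵥ-concat w []         = refl
Σᵥ-concat w (xs ∷ xss) = trans (Σᵥ-++ w xs (concat xss)) (cong (Σᵥ w xs +_) (Σᵥ-concat w xss))

Σᵥ-tabulate : ∀ (w : A → ℕ) (f : Fin n → A) → Σᵥ w (tabulate f) ≡ ∑[ i < n ] w (f i)
Σᵥ-tabulate {n = zero}  w f = refl
Σᵥ-tabulate {n = suc n} w f = cong (w (f zero) +_) (Σᵥ-tabulate w (f ∘ suc))

Σᵥ-*ˡ : ∀ c (w : A → ℕ) (xs : Vec A k) → Σᵥ (λ x → c * w x) xs ≡ c * Σᵥ w xs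
Σᵥ-*ˡ c w []       = sym (*-zeroʳ c)
Σᵥ-*ˡ c w (x ∷ xs) = trans (cong (c * w x +_) (Σᵥ-*ˡ c w xs)) (sym (*-distribˡ-+ c (w x) _))

Σᵥ-*ʳ : ∀ c (w : A → ℕ) (xs : Vec A k) → Σᵥ (λ x → w x * c) xs ≡ Σᵥ w xs * c
Σᵥ-*ʳ c w []       = refl
Σᵥ-*ʳ c w (x ∷ xs) = trans (cong (w x * c +_) (Σᵥ-*ʳ c w xs)) (sym (*-distribʳ-+ c (w x) _))

Σᵥ≡0⇒ : ∀ (w : A → ℕ) (xs : Vec A k) → Σᵥ w xs ≡ 0 → ∀ j → w (lookup xs j) ≡ 0
Σᵥ≡0⇒ w (x ∷ xs) s zero    = m+n≡0⇒m≡0 (w x) s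
Σᵥ≡0⇒ w (x ∷ xs) s (suc j) = Σᵥ≡0⇒ w xs (m+n≡0⇒n≡0 (w x) s) j

Σᵥ≡0⇐ : ∀ (w : A → ℕ) (xs : Vec A k) → (∀ j → w (lookup xs j) ≡ 0) → Σᵥ w xs ≡ 0
Σᵥ≡0⇐ w []       _     = refl
Σᵥ≡0⇐ w (x ∷ xs) zeros = cong₂ _+_ (zeros zero) (Σᵥ≡0⇐ w xs (zeros ∘ suc))

ExactlyOne : (A → ℕ) → Vec A k → Set
ExactlyOne {k = k} w xs =
  Σ (Fin k) λ i → w (lookup xs i) ≡ 1 × (∀ j → w (lookup xs j) ≡ 1 → j ≡ i)

Σᵥ≡1⇒exactlyOne : ∀ (w : A → ℕ) (xs : Vec A k) → Σᵥ w xs ≡ 1 → ExactlyOne w xs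
Σᵥ≡1⇒exactlyOne w (x ∷ xs) s with w x in wx
... | zero with Σᵥ≡1⇒exactlyOne w xs s
...   | i , wi , unique = suc i , wi , λ
  { zero    w≡1 → contradiction (trans (sym wx) w≡1) λ ()
  ; (suc j) w≡1 → cong suc (unique j w≡1) }
Σᵥ≡1⇒exactlyOne w (x ∷ xs) s | suc zero = zero , wx , unique
  where
    unique : ∀ j → w (lookup (x ∷ xs) j) ≡ 1 → j ≡ zero
    unique zero    _   = refl
    unique (suc j) w≡1 = contradiction (trans (sym w≡1) (Σᵥ≡0⇒ w xs (suc-injective s) j)) λ ()
Σᵥ≡1⇒exactlyOne w (x ∷ xs) s | suc (suc _) with () ← s

≤1∧≢1⇒0 : ∀ {m} → m ≤ 1 → m ≢ 1 → m ≡ 0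
≤1∧≢1⇒0 z≤n       _   = refl
≤1∧≢1⇒0 (s≤s z≤n) m≢1 = contradiction refl m≢1

exactlyOne⇒Σᵥ≡1 : ∀ (w : A → ℕ) (xs : Vec A k) → (∀ x → w x ≤ 1)
  → ExactlyOne w xs → Σᵥ w xs ≡ 1
exactlyOne⇒Σᵥ≡1 w (x ∷ xs) w≤1 (zero , wx , unique) =
  cong₂ _+_ wx (Σᵥ≡0⇐ w xs λ j → ≤1∧≢1⇒0 (w≤1 _) λ e → contradiction (unique (suc j) e) λ ())
exactlyOne⇒Σᵥ≡1 w (x ∷ xs) w≤1 (suc i , wi , unique) =
  cong₂ _+_ (≤1∧≢1⇒0 (w≤1 x) λ e → contradiction (unique zero e) λ ())
            (exactlyOne⇒Σᵥ≡1 w xs w≤1 (i , wi , λ j e → Finₚ.suc-injective (unique (suc j) e)))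

edgeAt : V → V → Bic V → ℕ
edgeAt u v B = edges B u v

record _decomposes_ {V : Set} {k} (bs : Vec (Bic V) k) (G : Graph V) : Set where
  constructor decomposition
  field multiplicity : ∀ u v → Σᵥ (edgeAt u v) bs ≡ G u v
open _decomposes_

BicBlock : Set → Set → Set
BicBlock V W = Bic V × Bic W

Bigraph : Set → Set → Set
Bigraph V W = V → V → W → W → ℕ

_⊗_ : Graph V → Graph W → Bigraph V W
(G ⊗ H) u v x y = G u v * H x y

_⊕_ : Bigraph V W → Bigraph V W → Bigraph V W
(F ⊕ F′) u v x y = F u v x y + F′ u v x y

blockWeight : BicBlock V W → Bigraph V W
blockWeight β = edges (proj₁ β) ⊗ edges (proj₂ β)

weightAt : V → V → W → W → BicBlock V W → ℕ
weightAt u v x y β = blockWeight β u v x y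

weightAt≤1 : ∀ (u v : V) (x y : W) β → weightAt u v x y β ≤ 1
weightAt≤1 u v x y (B , C) = *-mono-≤ (edges≤1 B u v) (edges≤1 C x y)

weightAt-loopˡ : ∀ (u : V) (x y : W) β → weightAt u u x y β ≡ 0
weightAt-loopˡ u x y (B , C) = cong (_* edges C x y) (edges-irreflexive B u)

weightAt-loopʳ : ∀ (u v : V) (x : W) β → weightAt u v x x β ≡ 0
weightAt-loopʳ u v x (B , C) = trans (cong (edges B u v *_) (edges-irreflexive C x)) (*-zeroʳ (edges B u v))

record _covers_ {V W : Set} {k} (bs : Vec (BicBlock V W) k) (F : Bigraph V W) : Set where
  constructor covering
  field coverage : ∀ u v x y → Σᵥ (weightAt u v x y) bs ≡ F u v x y
open _covers_

covers-cong : ∀ {bs : Vec (BicBlock V W) k} {F F′ : Bigraph V W}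
  → bs covers F → (∀ u v x y → F u v x y ≡ F′ u v x y) → bs covers F′
covers-cong c eq = covering λ u v x y → trans (coverage c u v x y) (eq u v x y)

covers-++ : ∀ {bs : Vec (BicBlock V W) k} {cs : Vec (BicBlock V W) l} {F F′}
  → bs covers F → cs covers F′ → (bs ++ cs) covers (F ⊕ F′)
covers-++ {bs = bs} {cs} c c′ = covering λ u v x y →
  trans (Σᵥ-++ (weightAt u v x y) bs cs) (cong₂ _+_ (coverage c u v x y) (coverage c′ u v x y))

covers-concat : ∀ (bss : Fin n → Vec (BicBlock V W) k) (F : Fin n → Bigraph V W)
  → (∀ i → bss i covers F i)
  → concat (tabulate bss) covers (λ u v x y → ∑[ i < n ] F i u v x y)
covers-concat bss F c = covering λ u v x y → let open ≡-Reasoning; w = weightAt u v x y in begin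
  Σᵥ w (concat (tabulate bss))   ≡⟨ Σᵥ-concat w (tabulate bss) ⟩
  Σᵥ (Σᵥ w) (tabulate bss)       ≡⟨ Σᵥ-tabulate (Σᵥ w) bss ⟩
  ∑[ i < _ ] Σᵥ w (bss i)         ≡⟨ sum-cong-≗ (λ i → coverage (c i) u v x y) ⟩
  ∑[ i < _ ] F i u v x y          ∎

decomposes-concat : ∀ (bss : Fin n → Vec (Bic V) k) (G : Fin n → Graph V)
  → (∀ i → bss i decomposes G i)
  → concat (tabulate bss) decomposes (λ u v → ∑[ i < n ] G i u v)
decomposes-concat bss G d = decomposition λ u v → let open ≡-Reasoning; w = edgeAt u v in begin
  Σᵥ w (concat (tabulate bss))   ≡⟨ Σᵥ-concat w (tabulate bss) ⟩
  Σᵥ (Σᵥ w) (tabulate bss)       ≡⟨ Σᵥ-tabulate (Σᵥ w) bss ⟩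
  ∑[ i < _ ] Σᵥ w (bss i)         ≡⟨ sum-cong-≗ (λ i → multiplicity (d i) u v) ⟩
  ∑[ i < _ ] G i u v              ∎

decomposes-cong : ∀ {bs : Vec (Bic V) k} {G G′ : Graph V}
  → bs decomposes G → (∀ u v → G u v ≡ G′ u v) → bs decomposes G′
decomposes-cong d eq = decomposition λ u v → trans (multiplicity d u v) (eq u v)

allBlocks : Vec (Bic V) k → Vec (Bic W) l → Vec (BicBlock V W) (k * l)
allBlocks bs cs = concat (map (λ B → map (B ,_) cs) bs)

covers-allBlocks : ∀ {bs : Vec (Bic V) k} {cs : Vec (Bic W) l} {G H}
  → bs decomposes G → cs decomposes H → allBlocks bs cs covers (G ⊗ H)
covers-allBlocks {bs = bs} {cs} {G} {H} dG dH = covering λ u v x y →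
  let open ≡-Reasoning; w = weightAt u v x y in begin
  Σᵥ w (allBlocks bs cs)
    ≡⟨ Σᵥ-concat w (map (λ B → map (B ,_) cs) bs) ⟩
  Σᵥ (Σᵥ w) (map (λ B → map (B ,_) cs) bs)
    ≡⟨ Σᵥ-map (Σᵥ w) (λ B → map (B ,_) cs) bs ⟩
  Σᵥ (λ B → Σᵥ w (map (B ,_) cs)) bs
    ≡⟨ Σᵥ-cong (λ B → Σᵥ-map w (B ,_) cs) bs ⟩
  Σᵥ (λ B → Σᵥ (λ C → edges B u v * edges C x y) cs) bs
    ≡⟨ Σᵥ-cong (λ B → trans (Σᵥ-*ˡ (edges B u v) (λ C → edges C x y) cs)
                            (cong (edges B u v *_) (multiplicity dH x y))) bs ⟩
  Σᵥ (λ B → edges B u v * H x y) bs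
    ≡⟨ Σᵥ-*ʳ (H x y) (λ B → edges B u v) bs ⟩
  Σᵥ (λ B → edges B u v) bs * H x y
    ≡⟨ cong (_* H x y) (multiplicity dG u v) ⟩
  G u v * H x y ∎

covers-swap : ∀ {bs : Vec (BicBlock V W) k} {G H}
  → bs covers (G ⊗ H) → map swap bs covers (H ⊗ G)
covers-swap {bs = bs} {G} {H} c = covering λ x y u v → let open ≡-Reasoning in begin
  Σᵥ (weightAt x y u v) (map swap bs)
    ≡⟨ Σᵥ-map (weightAt x y u v) swap bs ⟩
  Σᵥ (λ β → edges (proj₂ β) x y * edges (proj₁ β) u v) bs
    ≡⟨ Σᵥ-cong (λ β → *-comm (edges (proj₂ β) x y) _) bs ⟩
  Σᵥ (weightAt u v x y) bs
    ≡⟨ coverage c u v x y ⟩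
  G u v * H x y
    ≡⟨ *-comm (G u v) (H x y) ⟩
  H x y * G u v ∎

extend : Graph V → Graph (Maybe V)
extend G (just p) (just q) = G p q
extend G _        _        = 0

extend-nothingʳ : ∀ (G : Graph V) m → extend G m nothing ≡ 0
extend-nothingʳ G (just p) = refl
extend-nothingʳ G nothing  = refl

data BothDefined? {V : Set} : Maybe V → Maybe V → Set where
  both     : ∀ p q → BothDefined? (just p) (just q)
  not-both : ∀ {m m′} → (∀ G → extend G m m′ ≡ 0) → BothDefined? m m′

bothDefined? : ∀ (m m′ : Maybe V) → BothDefined? m m′
bothDefined? (just p) (just q) = both p q
bothDefined? (just p) nothing  = not-both λ _ → refl
bothDefined? nothing  m′       = not-both λ _ → refl

-- A relabelling of V′ by V: a partial map ρ that is onto, split by ι.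
-- Graphs and bicliques on V are transported to V′ along it.
record Relabelling (V′ V : Set) : Set where
  field
    ρ   : V′ → Maybe V
    ι   : V → V′
    ρ∘ι : ∀ v → ρ (ι v) ≡ just v
open Relabelling

total : (f : V′ → V) (s : V → V′) → (∀ v → f (s v) ≡ v) → Relabelling V′ V
total f s f∘s = record { ρ = just ∘ f ; ι = s ; ρ∘ι = cong just ∘ f∘s }

pull : Relabelling V′ V → Graph V → Graph V′
pull r G u v = extend G (ρ r u) (ρ r v)

liftSet : (V → Bool) → Maybe V → Bool
liftSet S (just v) = S v
liftSet S nothing  = false

relabel : Relabelling V′ V → Bic V → Bic V′
relabel {V′} {V} r B = mkBic (liftSet (X B) ∘ ρ r) (liftSet (Y B) ∘ ρ r)
  (witness (X B) (X-witness B)) (witness (Y B) (Y-witness B)) (λ u → separate (ρ r u))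
  where
    witness : ∀ S → Σ V (λ v → S v ≡ true) → Σ V′ λ u → liftSet S (ρ r u) ≡ true
    witness S (v , Sv) = ι r v , subst (λ m → liftSet S m ≡ true) (sym (ρ∘ι r v)) Sv
    separate : ∀ m → liftSet (X B) m ≡ true → liftSet (Y B) m ≡ false
    separate (just v) = disjoint B v
    separate nothing  ()

edges-relabel : ∀ (r : Relabelling V′ V) B u v → edges (relabel r B) u v ≡ pull r (edges B) u v
edges-relabel r B u v = extended (ρ r u) (ρ r v)
  where
    extended : ∀ m m′ → ind (crosses (liftSet (X B) m) (liftSet (Y B) m′) (liftSet (Y B) m) (liftSet (X B) m′))
      ≡ extend (edges B) m m′
    extended (just p) (just q) = refl
    extended (just p) nothing  = cong ind (cong₂ _∨_ (∧-zeroʳ (X B p)) (∧-zeroʳ (Y B p)))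
    extended nothing  _        = refl

decomposes-relabel : ∀ (r : Relabelling V′ V) {bs : Vec (Bic V) k} {G}
  → bs decomposes G → map (relabel r) bs decomposes pull r G
decomposes-relabel r {bs} {G} d = decomposition λ u v → begin
  Σᵥ (edgeAt u v) (map (relabel r) bs)           ≡⟨ Σᵥ-map (edgeAt u v) (relabel r) bs ⟩
  Σᵥ (λ B → edges (relabel r B) u v) bs           ≡⟨ Σᵥ-cong (λ B → edges-relabel r B u v) bs ⟩
  Σᵥ (λ B → extend (edges B) (ρ r u) (ρ r v)) bs  ≡⟨ transported (ρ r u) (ρ r v) ⟩
  extend G (ρ r u) (ρ r v)                        ∎
  where
    open ≡-Reasoning
    transported : ∀ m m′ → Σᵥ (λ B → extend (edges B) m m′) bs ≡ extend G m m′
    transported m m′ with bothDefined? m m′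
    ... | both p q     = multiplicity d p q
    ... | not-both ext0 = trans (Σᵥ≡0⇐ _ bs λ _ → ext0 _) (sym (ext0 G))

relabel₂ : Relabelling V′ V → Relabelling W′ W → BicBlock V W → BicBlock V′ W′
relabel₂ r s β = relabel r (proj₁ β) , relabel s (proj₂ β)

covers-relabel : ∀ (r : Relabelling V′ V) (s : Relabelling W′ W) {bs : Vec (BicBlock V W) k} {G H}
  → bs covers (G ⊗ H) → map (relabel₂ r s) bs covers (pull r G ⊗ pull s H)
covers-relabel r s {bs} {G} {H} c = covering λ u v x y → begin
  Σᵥ (weightAt u v x y) (map (relabel₂ r s) bs)
    ≡⟨ Σᵥ-map (weightAt u v x y) (relabel₂ r s) bs ⟩
  Σᵥ (λ β → edges (relabel r (proj₁ β)) u v * edges (relabel s (proj₂ β)) x y) bs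
    ≡⟨ Σᵥ-cong (λ β → cong₂ _*_ (edges-relabel r (proj₁ β) u v) (edges-relabel s (proj₂ β) x y)) bs ⟩
  Σᵥ (λ β → extend (edges (proj₁ β)) (ρ r u) (ρ r v) * extend (edges (proj₂ β)) (ρ s x) (ρ s y)) bs
    ≡⟨ transported (ρ r u) (ρ r v) (ρ s x) (ρ s y) ⟩
  extend G (ρ r u) (ρ r v) * extend H (ρ s x) (ρ s y) ∎
  where
    open ≡-Reasoning
    transported : ∀ m m′ n n′
      → Σᵥ (λ β → extend (edges (proj₁ β)) m m′ * extend (edges (proj₂ β)) n n′) bs
        ≡ extend G m m′ * extend H n n′
    transported m m′ n n′ with bothDefined? m m′ | bothDefined? n n′
    ... | both p q      | both p′ q′    = coverage c p q p′ q′
    ... | not-both ext0 | _             =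
      trans (Σᵥ≡0⇐ _ bs λ _ → cong (_* _) (ext0 _)) (sym (cong (_* _) (ext0 G)))
    ... | both p q      | not-both ext0 =
      trans (Σᵥ≡0⇐ _ bs λ j → let B = proj₁ (lookup bs j) in
               trans (cong (edges B p q *_) (ext0 _)) (*-zeroʳ (edges B p q)))
            (sym (trans (cong (G p q *_) (ext0 H)) (*-zeroʳ (G p q))))

_==_ : Fin n → Fin n → Bool
zero  == zero  = true
zero  == suc _ = false
suc _ == zero  = false
suc i == suc j = i == j

==-refl : ∀ (i : Fin n) → (i == i) ≡ true
==-refl zero    = refl
==-refl (suc i) = ==-refl i

≢⇒==false : ∀ {i j : Fin n} → i ≢ j → (i == j) ≡ false
≢⇒==false {i = zero}  {zero}  i≢j = contradiction refl i≢j
≢⇒==false {i = zero}  {suc j} _   = refl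
≢⇒==false {i = suc i} {zero}  _   = refl
≢⇒==false {i = suc i} {suc j} i≢j = ≢⇒==false (i≢j ∘ cong suc)

K : Graph (Fin n)
K u v = ind (not (u == v))

E : Graph (Fin n)
E u v = ind (u == v)

record IsComplete {V : Set} (G : Graph V) : Set where
  constructor complete
  field
    no-loops  : ∀ u → G u u ≡ 0
    all-edges : ∀ u v → u ≢ v → G u v ≡ 1
open IsComplete

K-complete : IsComplete (K {n})
K-complete = complete (λ u → cong (ind ∘ not) (==-refl u))
                      (λ u v u≢v → cong (ind ∘ not) (≢⇒==false u≢v))

complete-unique : DecidableEquality V → ∀ {G H : Graph V}
  → IsComplete G → IsComplete H → ∀ u v → G u v ≡ H u v
complete-unique _≟_ cG cH u v with u ≟ v
... | yes refl = trans (no-loops cG u) (sym (no-loops cH u))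
... | no u≢v   = trans (all-edges cG u v u≢v) (sym (all-edges cH u v u≢v))

complete-pullback : ∀ {G : Graph V} (f : V′ → V) → (∀ {u v} → f u ≡ f v → u ≡ v)
  → IsComplete G → IsComplete (λ u v → G (f u) (f v))
complete-pullback f f-inj cG =
  complete (λ u → no-loops cG (f u)) (λ u v u≢v → all-edges cG (f u) (f v) (u≢v ∘ f-inj))

isZero : Fin n → Bool
isZero zero    = true
isZero (suc _) = false

star : ∀ n → Bic (Fin (suc (suc n)))
star n = mkBic isZero (not ∘ isZero) (zero , refl) (suc zero , refl) centre
  where
    centre : ∀ v → isZero v ≡ true → not (isZero v) ≡ false
    centre zero _ = refl

dropZero : Relabelling (Fin (suc n)) (Fin n)
dropZero = record { ρ = below ; ι = suc ; ρ∘ι = λ _ → refl }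
  where
    below : Fin (suc _) → Maybe (Fin _)
    below zero    = nothing
    below (suc i) = just i

K-split : ∀ n (u v : Fin (suc (suc n))) → K u v ≡ edges (star n) u v + pull dropZero K u v
K-split n zero    zero    = refl
K-split n zero    (suc v) = refl
K-split n (suc u) zero    = refl
K-split n (suc u) (suc v) = refl

stars : ∀ n → Vec (Bic (Fin n)) (pred n)
stars zero          = []
stars (suc zero)    = []
stars (suc (suc n)) = star n ∷ map (relabel dropZero) (stars (suc n))

stars-decompose : ∀ n → stars n decomposes K
stars-decompose zero          = decomposition λ ()
stars-decompose (suc zero)    = decomposition λ { zero zero → refl }
stars-decompose (suc (suc n)) = decomposition λ u v →
  trans (cong (edges (star n) u v +_) (multiplicity (decomposes-relabel dropZero (stars-decompose (suc n))) u v))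
        (sym (K-split n u v))

record Saving (n m d : ℕ) : Set where
  field
    size   : ℕ
    blocks : Vec (BicBlock (Fin n) (Fin m)) size
    covers : blocks covers (K ⊗ K)
    count  : size + d ≡ pred n * pred m

saving-trivial : Saving 1 1 0
saving-trivial = record
  { size = 0 ; blocks = [] ; covers = covering λ { zero zero zero zero → refl } ; count = refl }

saving-swap : ∀ {n m d} → Saving n m d → Saving m n d
saving-swap {n} {m} S = record
  { size = size ; blocks = map swap blocks ; covers = covers-swap {G = K} {H = K} covers
  ; count = trans count (*-comm (pred n) (pred m)) }
  where open Saving S

identity : Relabelling V V
identity = total id id λ _ → refl

-- Adding a vertex keeps the saving: cover the new edges by star × stars.
saving-grow : ∀ {n m d} → Saving (suc n) m d → Saving (suc (suc n)) m d
saving-grow {n} {m} {d} S = record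
  { size = 1 * pred m + size
  ; blocks = allBlocks (star n ∷ []) (stars m) ++ map (relabel₂ dropZero identity) blocks
  ; covers = covers-cong
      (covers-++ (covers-allBlocks {bs = star n ∷ []} (decomposition λ _ _ → +-identityʳ _) (stars-decompose m))
                 (covers-relabel dropZero identity covers))
      (λ u v x y → trans (sym (*-distribʳ-+ (K x y) (edges (star n) u v) _))
                         (cong (_* K x y) (sym (K-split n u v))))
  ; count = trans (regroup (pred m) size d) (cong (pred m +_) count) }
  where
    open Saving S
    regroup : ∀ p k d → 1 * p + k + d ≡ p + (k + d)
    regroup = solve-∀

saving-widen : ∀ j {n m d} → Saving (suc n) m d → Saving (suc (j + n)) m d
saving-widen zero    S = S
saving-widen (suc j) S = saving-grow (saving-widen j S)

saving-mono : ∀ {x n d} → 1 ≤ x → x ≤ n → Saving x x d → Saving n n d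
saving-mono {suc x} {n} {d} _ x≤n S =
  subst (λ N → Saving N N d) grown (saving-widen j (saving-swap (saving-widen j S)))
  where
    j = n ∸ suc x
    grown : suc (j + x) ≡ n
    grown = trans (sym (+-suc j x)) (m∸n+n≡m x≤n)

-- Blowing up each vertex of K_A into T vertices gives Fin A × Fin T, on which
-- K_{AT} splits into the pairs with distinct first coordinates ("across")
-- and A disjoint copies of K_T ("within").

project : ∀ {A T} → Relabelling (Fin A × Fin (suc T)) (Fin A)
project = total proj₁ (_, zero) λ _ → refl

copy : ∀ {A T} → Fin A → Relabelling (Fin A × Fin T) (Fin T)
copy c = record
  { ρ   = λ u → if c == proj₁ u then just (proj₂ u) else nothing
  ; ι   = c ,_
  ; ρ∘ι = λ y → cong (λ b → if b then just y else nothing) (==-refl c) }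

inCopies : ∀ {A T} → Graph (Fin T) → Graph (Fin A × Fin T)
inCopies G u v = E (proj₁ u) (proj₁ v) * G (proj₂ u) (proj₂ v)

copies-sum : ∀ {A T} (G : Graph (Fin T)) (i j : Fin A) x y
  → ∑[ c < A ] pull (copy c) G (i , x) (j , y) ≡ inCopies G (i , x) (j , y)
copies-sum {suc A} G zero    zero    x y = cong (G x y +_) (sum-replicate-zero A)
copies-sum {suc A} G zero    (suc j) x y = sum-replicate-zero A
copies-sum {suc A} G (suc i) zero    x y =
  trans (sum-cong-≗ λ c → extend-nothingʳ G (if c == i then just x else nothing)) (sum-replicate-zero A)
copies-sum {suc A} G (suc i) (suc j) x y = copies-sum G i j x y

withinStars : ∀ A T → Vec (Bic (Fin A × Fin T)) (A * pred T)
withinStars A T = concat (tabulate λ c → map (relabel (copy c)) (stars T))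

withinStars-decompose : ∀ A T → withinStars A T decomposes inCopies K
withinStars-decompose A T = decomposes-cong
  (decomposes-concat _ _ λ c → decomposes-relabel (copy c) (stars-decompose T))
  λ u v → copies-sum K (proj₁ u) (proj₁ v) (proj₂ u) (proj₂ v)

acrossStars : ∀ A T → Vec (Bic (Fin A × Fin (suc T))) (pred A)
acrossStars A T = map (relabel project) (stars A)

acrossStars-decompose : ∀ A T → acrossStars A T decomposes pull project K
acrossStars-decompose A T = decomposes-relabel project (stars-decompose A)

copyBlocks : ∀ {A B T S} → Vec (BicBlock (Fin T) (Fin S)) k
  → Vec (BicBlock (Fin A × Fin T) (Fin B × Fin S)) (A * (B * k))
copyBlocks bs = concat (tabulate λ c → concat (tabulate λ c′ → map (relabel₂ (copy c) (copy c′)) bs))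

covers-copyBlocks : ∀ {A B T S} {bs : Vec (BicBlock (Fin T) (Fin S)) k} {G H}
  → bs covers (G ⊗ H) → copyBlocks {A = A} {B} bs covers (inCopies G ⊗ inCopies H)
covers-copyBlocks {A = A} {B} {G = G} {H} c = covers-cong
  (covers-concat _ _ λ i → covers-concat _ _ λ j → covers-relabel (copy i) (copy j) c)
  λ u v x y → trans (∑∑-product (λ i → pull (copy i) G u v) (λ j → pull (copy j) H x y))
    (cong₂ _*_ (copies-sum G (proj₁ u) (proj₁ v) (proj₂ u) (proj₂ v))
               (copies-sum H (proj₁ x) (proj₁ y) (proj₂ x) (proj₂ y)))
  where
    ∑∑-product : ∀ {m n} (f : Fin m → ℕ) (g : Fin n → ℕ)
      → ∑[ i < m ] ∑[ j < n ] (f i * g j) ≡ (∑[ i < m ] f i) * (∑[ j < n ] g j)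
    ∑∑-product f g = trans (sum-cong-≗ λ i → sym (*-distribˡ-sum (f i) g))
                           (sym (*-distribʳ-sum _ f))

blowupK : ∀ {A T} → Graph (Fin A × Fin T)
blowupK u v = K (proj₁ u) (proj₁ v) + inCopies K u v

blowupK-complete : ∀ {A T} → IsComplete (blowupK {A} {T})
blowupK-complete = complete loop edge
  where
    E-refl : ∀ {n} (i : Fin n) → E i i ≡ 1
    E-refl i = cong ind (==-refl i)
    loop : ∀ u → blowupK u u ≡ 0
    loop (i , x) = cong₂ _+_ (no-loops K-complete i) (cong₂ _*_ (E-refl i) (no-loops K-complete x))
    edge : ∀ u v → u ≢ v → blowupK u v ≡ 1
    edge (i , x) (j , y) u≢v with i Finₚ.≟ j
    ... | yes refl = cong₂ _+_ (no-loops K-complete i)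
                       (cong₂ _*_ (E-refl i) (all-edges K-complete x y (u≢v ∘ cong (i ,_))))
    ... | no i≢j   = cong₂ _+_ (all-edges K-complete i j i≢j) (cong (λ b → ind b * K x y) (≢⇒==false i≢j))

-- The blocks of the product construction: the outer covering pulled back
-- along the projections (across × across), stars × copies of stars
-- (across × within and within × across), and copies of the inner covering
-- (within × within).
blowupBlocks : ∀ {A B t s} → Vec (BicBlock (Fin A) (Fin B)) k → Vec (BicBlock (Fin (suc t)) (Fin (suc s))) l
  → Vec (BicBlock (Fin A × Fin (suc t)) (Fin B × Fin (suc s)))
        (k + (pred A * (B * s) + (A * t * pred B + A * (B * l))))
blowupBlocks {A = A} {B} {t} {s} outer inner =
  map (relabel₂ project project) outer
  ++ (allBlocks (acrossStars A t) (withinStars B (suc s))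
  ++ (allBlocks (withinStars A (suc t)) (acrossStars B s)
  ++ copyBlocks inner))

-- The four parts cover the four terms of (across + within) ⊗ (across + within).
covers-blowup : ∀ {A B t s} {outer : Vec (BicBlock (Fin A) (Fin B)) k}
  {inner : Vec (BicBlock (Fin (suc t)) (Fin (suc s))) l}
  → outer covers (K ⊗ K) → inner covers (K ⊗ K)
  → blowupBlocks outer inner covers (blowupK ⊗ blowupK)
covers-blowup {A = A} {B} {t} {s} c₀ c₁ = covers-cong
  (covers-++ (covers-relabel project project {G = K} {H = K} c₀)
  (covers-++ (covers-allBlocks (acrossStars-decompose A t) (withinStars-decompose B (suc s)))
  (covers-++ (covers-allBlocks (withinStars-decompose A (suc t)) (acrossStars-decompose B s))
             (covers-copyBlocks {G = K} {H = K} c₁))))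
  λ u v x y → expand (K (proj₁ u) (proj₁ v)) (inCopies K u v) (K (proj₁ x) (proj₁ y)) (inCopies K x y)
  where
    expand : ∀ p q p′ q′ → p * p′ + (p * q′ + (q * p′ + q * q′)) ≡ (p + q) * (p′ + q′)
    expand = solve-∀

unpair : ∀ {A T} → Relabelling (Fin (A * T)) (Fin A × Fin T)
unpair {T = T} = total (remQuot T) (uncurry combine) λ w → Finₚ.remQuot-combine (proj₁ w) (proj₂ w)

-- Both graphs on Fin (A · T) are complete, hence equal.
unpair-K : ∀ {A T} (u v : Fin (A * T)) → pull (unpair {A} {T}) blowupK u v ≡ K u v
unpair-K {A} {T} = complete-unique Finₚ._≟_
  (complete-pullback (remQuot {A} T) remQuot-injective blowupK-complete) K-complete
  where
    remQuot-injective : ∀ {u v : Fin (A * T)} → remQuot {A} T u ≡ remQuot T v → u ≡ v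
    remQuot-injective {u} {v} eq = trans (sym (Finₚ.combine-remQuot {A} T u))
      (trans (cong (uncurry combine) eq) (Finₚ.combine-remQuot {A} T v))

blowup-count : ∀ k₀ k₁ δ d a b t s → k₀ + δ ≡ a * b → k₁ + d ≡ t * s
  → (k₀ + (a * (suc b * s) + (suc a * t * b + suc a * (suc b * k₁)))) + (δ + suc a * suc b * d)
    ≡ (t + a * suc t) * (s + b * suc s)
blowup-count k₀ k₁ δ d a b t s outer inner = begin
  (k₀ + (a * (suc b * s) + (suc a * t * b + suc a * (suc b * k₁)))) + (δ + suc a * suc b * d)
    ≡⟨ regroup k₀ k₁ δ d a b t s ⟩
  (k₀ + δ) + (a * (suc b * s) + (suc a * t * b + suc a * suc b * (k₁ + d)))
    ≡⟨ cong₂ (λ p q → p + (a * (suc b * s) + (suc a * t * b + suc a * suc b * q))) outer inner ⟩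
  a * b + (a * (suc b * s) + (suc a * t * b + suc a * suc b * (t * s)))
    ≡⟨ expand a b t s ⟩
  (t + a * suc t) * (s + b * suc s) ∎
  where
    open ≡-Reasoning
    regroup : ∀ k₀ k₁ δ d a b t s
      → (k₀ + (a * (suc b * s) + (suc a * t * b + suc a * (suc b * k₁)))) + (δ + suc a * suc b * d)
        ≡ (k₀ + δ) + (a * (suc b * s) + (suc a * t * b + suc a * suc b * (k₁ + d)))
    regroup = solve-∀
    expand : ∀ a b t s → a * b + (a * (suc b * s) + (suc a * t * b + suc a * suc b * (t * s)))
      ≡ (t + a * suc t) * (s + b * suc s)
    expand = solve-∀

-- Blowing up K_a × K_b by K_t × K_s: the savings of the outer product are
-- kept, and every one of the ab copies of K_t × K_s saves d.
saving-blowup : ∀ {a b t s δ d} → 1 ≤ a → 1 ≤ b → 1 ≤ t → 1 ≤ s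
  → Saving a b δ → Saving t s d → Saving (a * t) (b * s) (δ + a * b * d)
saving-blowup {suc a} {suc b} {suc t} {suc s} {δ} {d} _ _ _ _ outer inner = record
  { size   = _
  ; blocks = map (relabel₂ (unpair {suc a}) (unpair {suc b})) (blowupBlocks O.blocks I.blocks)
  ; covers = covers-cong
               (covers-relabel (unpair {suc a} {suc t}) (unpair {suc b} {suc s}) {G = blowupK} {H = blowupK}
                               (covers-blowup O.covers I.covers))
               λ u v x y → cong₂ _*_ (unpair-K {suc a} {suc t} u v) (unpair-K {suc b} {suc s} x y)
  ; count  = blowup-count O.size I.size δ d a b t s O.count I.count }
  where
    module O = Saving outer
    module I = Saving inner

∈⇒lookup : ∀ {i : Fin n} {S : Subset n} → i ∈ S → lookup S i ≡ true
∈⇒lookup = []=⇒lookup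

lookup⇒∈ : ∀ {i : Fin n} {S : Subset n} → lookup S i ≡ true → i ∈ S
lookup⇒∈ = lookup⇒[]= _ _

fromBiclique : Biclique n → Bic (Fin n)
fromBiclique B = mkBic (lookup B.X) (lookup B.Y)
  (proj₁ B.X-nonempty , ∈⇒lookup (proj₂ B.X-nonempty))
  (proj₁ B.Y-nonempty , ∈⇒lookup (proj₂ B.Y-nonempty)) separate
  where
    module B = Biclique B
    separate : ∀ i → lookup B.X i ≡ true → lookup B.Y i ≡ false
    separate i i∈X with lookup B.Y i in i∈Y
    ... | false = refl
    ... | true  = contradiction (lookup⇒∈ i∈Y) (B.disjoint i (lookup⇒∈ i∈X))

toBiclique : Bic (Fin n) → Biclique n
toBiclique B = record
  { X = tabulate (X B) ; Y = tabulate (Y B)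
  ; X-nonempty = proj₁ (X-witness B) , inside (X B) (proj₂ (X-witness B))
  ; Y-nonempty = proj₁ (Y-witness B) , inside (Y B) (proj₂ (Y-witness B))
  ; disjoint = λ i i∈X i∈Y →
      contradiction (trans (sym (disjoint B i (outside (X B) i∈X))) (outside (Y B) i∈Y)) λ () }
  where
    inside : ∀ {i} (S : Fin _ → Bool) → S i ≡ true → i ∈ tabulate S
    inside {i} S Si = lookup⇒∈ (trans (lookup∘tabulate S i) Si)
    outside : ∀ {i} (S : Fin _ → Bool) → i ∈ tabulate S → S i ≡ true
    outside {i} S i∈S = trans (sym (lookup∘tabulate S i)) (∈⇒lookup i∈S)

edges-roundtrip : ∀ (B : Bic (Fin n)) u v → edges (fromBiclique (toBiclique B)) u v ≡ edges B u v
edges-roundtrip B u v rewrite lookup∘tabulate (X B) u | lookup∘tabulate (Y B) v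
                            | lookup∘tabulate (Y B) u | lookup∘tabulate (X B) v = refl

ends : Edge n → Fin n × Fin n
ends = proj₁

∈E⇔ : ∀ (e : Edge n) B → e ∈E B ⇔ edges (fromBiclique B) (proj₁ (ends e)) (proj₂ (ends e)) ≡ 1
∈E⇔ ((u , v) , _) B = mk⇔
  (λ { (inj₁ (u∈X , v∈Y)) → from bits (inj₁ (∈⇒lookup u∈X , ∈⇒lookup v∈Y))
     ; (inj₂ (u∈Y , v∈X)) → from bits (inj₂ (∈⇒lookup u∈Y , ∈⇒lookup v∈X)) })
  (λ e≡1 → ⊎-map (λ (a , b) → lookup⇒∈ a , lookup⇒∈ b) (λ (a , b) → lookup⇒∈ a , lookup⇒∈ b)
                 (to bits e≡1))
  where
    module B = Biclique B
    bits : edges (fromBiclique B) u v ≡ 1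
         ⇔ ((lookup B.X u ≡ true × lookup B.Y v ≡ true) ⊎ (lookup B.Y u ≡ true × lookup B.X v ≡ true))
    bits = crosses≡1⇔ (lookup B.X u) (lookup B.Y v) (lookup B.Y u) (lookup B.X v)

fromBlock : ∀ {a b} → Block a b → BicBlock (Fin a) (Fin b)
fromBlock (B , C) = fromBiclique B , fromBiclique C

toBlock : ∀ {a b} → BicBlock (Fin a) (Fin b) → Block a b
toBlock (B , C) = toBiclique B , toBiclique C

weightOn : ∀ {a b} → Edge a → Edge b → BicBlock (Fin a) (Fin b) → ℕ
weightOn e f = weightAt (proj₁ (ends e)) (proj₂ (ends e)) (proj₁ (ends f)) (proj₂ (ends f))

∈Block⇔ : ∀ {a b} (e : Edge a) (f : Edge b) β → (e , f) ∈Block β ⇔ weightOn e f (fromBlock β) ≡ 1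
∈Block⇔ e f (B , C) = mk⇔
  (λ (e∈B , f∈C) → cong₂ _*_ (to (∈E⇔ e B) e∈B) (to (∈E⇔ f C) f∈C))
  (λ w≡1 → from (∈E⇔ e B) (m*n≡1⇒m≡1 (edgesOf e B) (edgesOf f C) w≡1)
          , from (∈E⇔ f C) (m*n≡1⇒n≡1 (edgesOf e B) (edgesOf f C) w≡1))
  where
    edgesOf : ∀ {n} → Edge n → Biclique n → ℕ
    edgesOf e B = edges (fromBiclique B) (proj₁ (ends e)) (proj₂ (ends e))

weightOn-roundtrip : ∀ {a b} (e : Edge a) (f : Edge b) β
  → weightOn e f (fromBlock (toBlock β)) ≡ weightOn e f β
weightOn-roundtrip ((u , v) , _) ((x , y) , _) (B , C) =
  cong₂ _*_ (edges-roundtrip B u v) (edges-roundtrip C x y)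

orient : ∀ (u v : Fin n) → u ≢ v
  → Σ (Edge n) λ e → ∀ B → edges B u v ≡ edges B (proj₁ (ends e)) (proj₂ (ends e))
orient u v u≢v with Finₚ.<-cmp u v
... | tri< u<v _ _ = ((u , v) , u<v) , λ _ → refl
... | tri≈ _ u≡v _ = contradiction u≡v u≢v
... | tri> _ _ v<u = ((v , u) , v<u) , λ B → edges-sym B u v

partition⇒exactlyOne : ∀ {a b} {bs : Vec (Block a b) k} → IsPartition bs
  → ∀ e f → ExactlyOne (weightOn e f ∘ fromBlock) bs
partition⇒exactlyOne {bs = bs} isPartition e f with isPartition e f
... | i , ef∈i , unique = i , to (∈Block⇔ e f (lookup bs i)) ef∈i
                        , λ j w≡1 → unique j (from (∈Block⇔ e f (lookup bs j)) w≡1)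

partition⇒covering : ∀ {a b} → HasPartition a b k
  → Σ (Vec (BicBlock (Fin a) (Fin b)) k) (_covers (K ⊗ K))
partition⇒covering (bs , isPartition) = map fromBlock bs , covering λ u v x y →
  trans (Σᵥ-map (weightAt u v x y) fromBlock bs) (coverage′ u v x y)
  where
    coverage′ : ∀ u v x y → Σᵥ (weightAt u v x y ∘ fromBlock) bs ≡ K u v * K x y
    coverage′ u v x y with u Finₚ.≟ v | x Finₚ.≟ y
    ... | yes refl | _ = trans (Σᵥ≡0⇐ _ bs λ j → weightAt-loopˡ u x y (fromBlock (lookup bs j)))
                               (sym (cong (_* K x y) (no-loops K-complete u)))
    ... | no _ | yes refl = trans (Σᵥ≡0⇐ _ bs λ j → weightAt-loopʳ u v x (fromBlock (lookup bs j)))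
                                  (sym (trans (cong (K u v *_) (no-loops K-complete x)) (*-zeroʳ (K u v))))
    ... | no u≢v | no x≢y = begin
      Σᵥ (weightAt u v x y ∘ fromBlock) bs
        ≡⟨ Σᵥ-cong (λ β → cong₂ _*_ (oriented-u (proj₁ (fromBlock β)))
                                     (oriented-x (proj₂ (fromBlock β)))) bs ⟩
      Σᵥ (weightOn e f ∘ fromBlock) bs
        ≡⟨ exactlyOne⇒Σᵥ≡1 _ bs (weightAt≤1 _ _ _ _ ∘ fromBlock)
                             (partition⇒exactlyOne {bs = bs} isPartition e f) ⟩
      1
        ≡⟨ sym (cong₂ _*_ (all-edges K-complete u v u≢v) (all-edges K-complete x y x≢y)) ⟩
      K u v * K x y ∎
      where
        open ≡-Reasoning
        e : Edge _
        e = proj₁ (orient u v u≢v)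
        f : Edge _
        f = proj₁ (orient x y x≢y)
        oriented-u : ∀ B → edges B u v ≡ edges B (proj₁ (ends e)) (proj₂ (ends e))
        oriented-u = proj₂ (orient u v u≢v)
        oriented-x : ∀ C → edges C x y ≡ edges C (proj₁ (ends f)) (proj₂ (ends f))
        oriented-x = proj₂ (orient x y x≢y)

∈toBlock⇔ : ∀ {a b} (e : Edge a) (f : Edge b) β → (e , f) ∈Block toBlock β ⇔ weightOn e f β ≡ 1
∈toBlock⇔ e f β = mk⇔
  (λ ef∈β → trans (sym (weightOn-roundtrip e f β)) (to (∈Block⇔ e f (toBlock β)) ef∈β))
  (λ w≡1 → from (∈Block⇔ e f (toBlock β)) (trans (weightOn-roundtrip e f β) w≡1))

covering⇒partition : ∀ {a b} (bs : Vec (BicBlock (Fin a) (Fin b)) k) → bs covers (K ⊗ K)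
  → HasPartition a b k
covering⇒partition bs c = map toBlock bs , isPartition
  where
    weightOne : ∀ e f → Σᵥ (weightOn e f) bs ≡ 1
    weightOne ((u , v) , u<v) ((x , y) , x<y) = trans (coverage c u v x y)
      (cong₂ _*_ (all-edges K-complete u v (Finₚ.<⇒≢ u<v)) (all-edges K-complete x y (Finₚ.<⇒≢ x<y)))
    ∈lookup⇔ : ∀ e f j → (e , f) ∈Block lookup (map toBlock bs) j ⇔ weightOn e f (lookup bs j) ≡ 1
    ∈lookup⇔ e f j = subst (λ β → (e , f) ∈Block β ⇔ weightOn e f (lookup bs j) ≡ 1)
                           (sym (lookup-map j toBlock bs)) (∈toBlock⇔ e f (lookup bs j))
    isPartition : IsPartition (map toBlock bs)
    isPartition e f with Σᵥ≡1⇒exactlyOne (weightOn e f) bs (weightOne e f)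
    ... | i , wi , unique = i , from (∈lookup⇔ e f i) wi , λ j ef∈j → unique j (to (∈lookup⇔ e f j) ef∈j)

g≤size : ∀ {n m d} → IsG n n m → Saving n n d → m + d ≤ pred n * pred n
g≤size (_ , minimal) S = ≤-trans (+-monoˡ-≤ _ (minimal size (covering⇒partition blocks covers)))
                                 (≤-reflexive count)
  where open Saving S

saving-from-partition : ∀ {a b} → HasPartition a b k → k ≤ pred a * pred b
  → Saving a b (pred a * pred b ∸ k)
saving-from-partition {k} P k≤ = record
  { size = k ; blocks = proj₁ (partition⇒covering P) ; covers = proj₂ (partition⇒covering P)
  ; count = m+[n∸m]≡n k≤ }

density-arith : ∀ m d P Z → m + d ≤ P * P → P * P ≤ Z * d + Z → m * suc Z ≤ Z * (suc P * suc P)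
density-arith m d P Z m+d≤P² P²≤Zd+Z = begin
  m * suc Z              ≤⟨ +-cancelʳ-≤ (Z * d) (m * suc Z) (Z + Z * (P * P)) shifted ⟩
  Z + Z * (P * P)        ≤⟨ m≤m+n (Z + Z * (P * P)) (Z * (P + P)) ⟩
  Z + Z * (P * P) + Z * (P + P) ≡⟨ square Z P ⟩
  Z * (suc P * suc P)    ∎
  where
    open ≤-Reasoning
    square : ∀ Z P → Z + Z * (P * P) + Z * (P + P) ≡ Z * (suc P * suc P)
    square = solve-∀
    shifted : m * suc Z + Z * d ≤ Z + Z * (P * P) + Z * d
    shifted = begin
      m * suc Z + Z * d          ≡⟨ regroup m d Z ⟩
      m + Z * (m + d)            ≤⟨ +-mono-≤ (≤-trans (≤-trans (m≤m+n m d) m+d≤P²) P²≤Zd+Z)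
                                             (*-monoʳ-≤ Z m+d≤P²) ⟩
      Z * d + Z + Z * (P * P)    ≡⟨ swap-terms (Z * d) Z (Z * (P * P)) ⟩
      Z + Z * (P * P) + Z * d    ∎
      where
        regroup : ∀ m d Z → m * suc Z + Z * d ≡ m + Z * (m + d)
        regroup = solve-∀
        swap-terms : ∀ p q r → p + q + r ≡ q + r + p
        swap-terms = solve-∀

-- One saving δ ≥ 1 for K_a × K_b with N = ab ≥ 2 amplifies, by iterated
-- blow-ups, to savings for all K_n × K_n that are a fixed fraction of n².
module Amplification {a b δ : ℕ} (a≥1 : 1 ≤ a) (b≥1 : 1 ≤ b) (δ≥1 : 1 ≤ δ) (N≥2 : 2 ≤ a * b)
                     (seed : Saving a b δ) where

  N : ℕ
  N = a * b

  N≥1 : 1 ≤ N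
  N≥1 = ≤-trans (s≤s z≤n) N≥2

  square-product : ∀ N x → N * x * (N * x) ≡ N * N * (x * x)
  square-product = solve-∀

  N^r≥1 : ∀ r → 1 ≤ N ^ r
  N^r≥1 zero    = ≤-refl
  N^r≥1 (suc r) = *-mono-≤ N≥1 (N^r≥1 r)

  -- Blowing up by K_a × K_b and then by K_b × K_a multiplies the
  -- saving by N² and adds at least 1.
  round : ∀ {x d} → 1 ≤ x → Saving x x d
    → Σ ℕ λ d′ → Saving (N * x) (N * x) d′ × suc (N * N * d) ≤ d′
  round {x} {d} x≥1 S = δ + b * a * (δ + a * b * d)
    , subst₂ (λ p q → Saving p q (δ + b * a * (δ + a * b * d))) (reorder a b x) (sym (*-assoc a b x)) twice
    , grows
    where
      once : Saving (a * x) (b * x) (δ + a * b * d)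
      once = saving-blowup a≥1 b≥1 x≥1 x≥1 seed S
      twice : Saving (b * (a * x)) (a * (b * x)) (δ + b * a * (δ + a * b * d))
      twice = saving-blowup b≥1 a≥1 (*-mono-≤ a≥1 x≥1) (*-mono-≤ b≥1 x≥1) (saving-swap seed) once
      reorder : ∀ a b x → b * (a * x) ≡ a * b * x
      reorder = solve-∀
      expand : ∀ a b δ d → δ + b * a * (δ + a * b * d) ≡ δ + (b * a * δ + a * b * (a * b) * d)
      expand = solve-∀
      grows : suc (N * N * d) ≤ δ + b * a * (δ + a * b * d)
      grows = ≤-trans (+-mono-≤ δ≥1 (m≤n+m (N * N * d) (b * a * δ))) (≤-reflexive (sym (expand a b δ d)))

  tower : ∀ r → Σ ℕ λ d → Saving (N ^ r) (N ^ r) d × N ^ r * N ^ r ≤ N * N * d + 1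
  tower zero = 0 , saving-trivial , m≤n+m 1 (N * N * 0)
  tower (suc r) with tower r
  ... | d , S , bound with round (N^r≥1 r) S
  ... | d′ , S′ , grows = d′ , S′ , (begin
    N * x * (N * x)          ≡⟨ square-product N x ⟩
    N * N * (x * x)          ≤⟨ *-monoʳ-≤ (N * N) bound ⟩
    N * N * (N * N * d + 1)  ≡⟨ cong (N * N *_) (+-comm (N * N * d) 1) ⟩
    N * N * suc (N * N * d)  ≤⟨ *-monoʳ-≤ (N * N) grows ⟩
    N * N * d′               ≤⟨ m≤m+n (N * N * d′) 1 ⟩
    N * N * d′ + 1           ∎)
    where
      open ≤-Reasoning
      x : ℕ
      x = N ^ r

  bracket : ∀ n → 1 ≤ n → Σ ℕ λ r → N ^ r ≤ n × n ≤ N * N ^ r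
  bracket (suc zero) _ = 0 , ≤-refl , ≤-trans N≥1 (≤-reflexive (sym (*-identityʳ N)))
  bracket (suc (suc n)) _ with bracket (suc n) (s≤s z≤n)
  ... | r , lo , hi with suc (suc n) ≤? N * N ^ r
  ...   | yes fits    = r , m≤n⇒m≤1+n lo , fits
  ...   | no overflow = suc r , ≤-trans (≤-reflexive N^r≡) (n≤1+n (suc n))
                      , subst (λ y → suc (suc n) ≤ N * y) (sym N^r≡)
                              (≤-trans (m<m*n (suc n) N N≥2) (≤-reflexive (*-comm (suc n) N)))
    where
      N^r≡ : N * N ^ r ≡ suc n
      N^r≡ = ≤-antisym (≮⇒≥ overflow) hi

  Z : ℕ
  Z = N * N * (N * N)

  density : ∀ n m → IsG n n m → m * suc Z ≤ Z * (n * n)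
  density zero    m (_ , minimal) =
    ≤-trans (*-monoˡ-≤ (suc Z) (minimal 0 ([] , λ { ((() , _) , _) _ }))) z≤n
  density (suc P) m isG with bracket (suc P) (s≤s z≤n)
  ... | r , lo , hi with tower r
  ... | d , S , bound = density-arith m d P Z (g≤size isG (saving-mono (N^r≥1 r) lo S)) P²≤Zd+Z
    where
      open ≤-Reasoning
      x : ℕ
      x = N ^ r
      distribute : ∀ N d → N * N * (N * N * d + 1) ≡ N * N * (N * N) * d + N * N
      distribute = solve-∀
      N²≤Z : N * N ≤ Z
      N²≤Z = ≤-trans (≤-reflexive (sym (*-identityʳ (N * N)))) (*-monoʳ-≤ (N * N) (*-mono-≤ N≥1 N≥1))
      P²≤Zd+Z : P * P ≤ Z * d + Z
      P²≤Zd+Z = begin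
        P * P                    ≤⟨ *-mono-≤ (n≤1+n P) (n≤1+n P) ⟩
        suc P * suc P            ≤⟨ *-mono-≤ hi hi ⟩
        N * x * (N * x)          ≡⟨ square-product N x ⟩
        N * N * (x * x)          ≤⟨ *-monoʳ-≤ (N * N) bound ⟩
        N * N * (N * N * d + 1)  ≡⟨ distribute N d ⟩
        Z * d + N * N            ≤⟨ +-monoʳ-≤ (Z * d) N²≤Z ⟩
        Z * d + Z                ∎

∸1≡pred : ∀ n → n ∸ 1 ≡ pred n
∸1≡pred zero    = refl
∸1≡pred (suc n) = refl

two≤product : ∀ a b → 0 < pred a * pred b → 2 ≤ a * b
two≤product (suc (suc a)) (suc (suc b)) _   = s≤s (s≤s z≤n)
two≤product (suc (suc a)) (suc zero)    pos = contradiction (subst (0 <_) (*-zeroʳ (suc a)) pos) λ ()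
two≤product (suc (suc a)) zero          pos = contradiction (subst (0 <_) (*-zeroʳ (suc a)) pos) λ ()

proposition2 : (a b : ℕ) → a ≥ 1 → b ≥ 1 → (k : ℕ) → IsG a b k
    → k < (a ∸ 1) * (b ∸ 1)
    → ∃ λ (p : ℕ) → ∃ λ (q : ℕ) → (p < q)
      × (∀ (n m : ℕ) → IsG n n m → m * q ≤ p * (n * n))
proposition2 a b a≥1 b≥1 k (partition , _) k<ab = Z , suc Z , ≤-refl , density
  where
    k<P : k < pred a * pred b
    k<P = subst₂ (λ p q → k < p * q) (∸1≡pred a) (∸1≡pred b) k<ab
    open Amplification a≥1 b≥1 (m<n⇒0<n∸m k<P) (two≤product a b (≤-trans (s≤s z≤n) k<P))
                       (saving-from-partition partition (<⇒≤ k<P))
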